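{- Let $\mathbf{s}$ be a standard episturmian word with directive word $\Delta(\mathbf{s})=x_1x_2\cdots$. Let $n\ge2$ be such that there exists $i<n$ with $x_i=x_n$, and let $P(n)$ be the largest such $i$. Then $$h_{n-1}=h_{n-2}h_{n-3}\cdots h_{P(n)-1}.$$
   Context: An infinite word is episturmian if its set of factors is closed under reversal and for each length $\ell$ it has at most one right special factor of length $\ell$; it is standard if all its left special factors are prefixes of it. For a word $w$, $w^{(+)}$ is the shortest palindrome having $w$ as a prefix. If $u_1=\varepsilon,u_2,u_3,\ldots$ is the sequence of palindromic prefixes of a standard episturmian word $\mathbf{s}$ (in increasing length), there is an infinite word $\Delta(\mathbf{s})=x_1x_2\cdots$ over the alphabet (its directive word) with $u_{n+1}=(u_nx_n)^{(+)}$ for all $n\ge1$. For a letter $a$ let $\psi_a$ be the morphism with $\psi_a(a)=a$ and $\psi_a(x)=ax$ for $x\neq a$; let $\mu_0=\mathrm{Id}$, $\mu_n=\psi_{x_1}\cdots\psi_{x_n}$, and $h_n=\mu_n(x_{n+1})$ for $n\ge0$. -}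

module Defs where

open import Data.Nat using (ℕ; zero; suc; _+_; _∸_; _≤_; _<_)
open import Data.Fin using (Fin; _≟_)
open import Data.List using (List; []; _∷_; _++_; [_]; length; reverse; concatMap)
open import Data.Product using (Σ; ∃; _×_; _,_)
open import Relation.Binary.PropositionalEquality using (_≡_; _≢_)
open import Relation.Nullary using (does)
open import Data.Bool using (if_then_else_)

Letter : ℕ → Set
Letter k = Fin k

InfWord : ℕ → Set
InfWord k = ℕ → Letter k

slice : ∀ {k} → InfWord k → ℕ → ℕ → List (Letter k)
slice s i zero = []
slice s i (suc m) = s i ∷ slice s (suc i) m

Factor : ∀ {k} → InfWord k → List (Letter k) → Set
Factor s w = ∃ λ i → slice s i (length w) ≡ w

Prefix : ∀ {k} → InfWord k → List (Letter k) → Set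
Prefix s w = slice s 0 (length w) ≡ w

RightSpecial : ∀ {k} → InfWord k → List (Letter k) → Set
RightSpecial s w = Σ _ λ a → Σ _ λ b → a ≢ b × Factor s (w ++ [ a ]) × Factor s (w ++ [ b ])

LeftSpecial : ∀ {k} → InfWord k → List (Letter k) → Set
LeftSpecial s w = Σ _ λ a → Σ _ λ b → a ≢ b × Factor s (a ∷ w) × Factor s (b ∷ w)

Episturmian : ∀ {k} → InfWord k → Set
Episturmian s =
  (∀ w → Factor s w → Factor s (reverse w)) ×
  (∀ u v → RightSpecial s u → RightSpecial s v → length u ≡ length v → u ≡ v)

Standard : ∀ {k} → InfWord k → Set
Standard s = ∀ w → LeftSpecial s w → Prefix s w

StandardEpisturmian : ∀ {k} → InfWord k → Set
StandardEpisturmian s = Episturmian s × Standard s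

Palindrome : ∀ {A : Set} → List A → Set
Palindrome w = reverse w ≡ w

IsPrefixOf : ∀ {A : Set} → List A → List A → Set
IsPrefixOf w p = ∃ λ t → w ++ t ≡ p

IsPalClosure : ∀ {A : Set} → List A → List A → Set
IsPalClosure w p =
  Palindrome p × IsPrefixOf w p ×
  (∀ q → Palindrome q → IsPrefixOf w q → length p ≤ length q)

-- Directive word, with the paper's 1-based indexing: x 1, x 2, ... are x_1, x_2, ...
-- (x 0 is ignored). u n (n ≥ 1) is the n-th palindromic prefix u_n.
IsDirectiveWord : ∀ {k} → InfWord k → (ℕ → Letter k) → Set
IsDirectiveWord s x = Σ (ℕ → List _) λ u →
  (u 1 ≡ []) ×
  (∀ n → 1 ≤ n → Prefix s (u n) × Palindrome (u n)) ×
  (∀ n → 1 ≤ n → length (u n) < length (u (suc n))) ×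
  (∀ w → Prefix s w → Palindrome w → ∃ λ n → 1 ≤ n × u n ≡ w) ×
  (∀ n → 1 ≤ n → IsPalClosure (u n ++ [ x n ]) (u (suc n)))

psi : ∀ {k} → Letter k → List (Letter k) → List (Letter k)
psi a = concatMap (λ y → if does (y ≟ a) then [ a ] else (a ∷ [ y ]))

-- μ_n = ψ_{x_1} ∘ ... ∘ ψ_{x_n}, μ_0 = Id  (so μ_{n+1} = μ_n ∘ ψ_{x_{n+1}})
mu : ∀ {k} → (ℕ → Letter k) → ℕ → List (Letter k) → List (Letter k)
mu x zero w = w
mu x (suc n) w = mu x n (psi (x (suc n)) w)

h : ∀ {k} → (ℕ → Letter k) → ℕ → List (Letter k)
h x n = mu x n [ x (suc n) ]

hprod : ∀ {k} → (ℕ → Letter k) → ℕ → ℕ → List (Letter k)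
hprod x j zero = []
hprod x j (suc c) = h x j ++ hprod x (j ∸ 1) c

-- Since ψ_b(a) is a when b = a and b a otherwise, μ_{j+1}(a) = μ_j(ψ_{x_{j+1}}(a)) is
-- h_j when x_{j+1} = a and h_j μ_j(a) otherwise. Unfolding μ_{n-1}(x_n) one step at a
-- time peels off h_{n-2}, h_{n-3}, … until the index reaches P, the last earlier
-- occurrence of x_n, where μ_P(x_n) = h_{P-1} closes the product.
module Submission where

open import Defs
open import Data.Nat using (ℕ; zero; suc; _+_; _∸_; _≤_; _<_; s≤s)
open import Data.Nat.Properties using (+-suc; +-identityʳ; m+n∸m≡n; m≤m+n; n≤1+n; ≤-refl; ≤-trans; m≤n⇒∃[o]m+o≡n)
open import Data.List using (List; _∷_; _++_; [_])
open import Data.List.Properties using (concatMap-++; ++-identityʳ)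
open import Data.Fin using (_≟_)
open import Data.Product using (_,_)
open import Data.Empty using (⊥-elim)
open import Relation.Nullary using (yes; no)
open import Relation.Binary.PropositionalEquality using (_≡_; _≢_; refl; sym; trans; cong; module ≡-Reasoning)

mu-++ : ∀ {k} (x : ℕ → Letter k) n (u v : List (Letter k)) → mu x n (u ++ v) ≡ mu x n u ++ mu x n v
mu-++ x zero    u v = refl
mu-++ x (suc n) u v = trans (cong (mu x n) (concatMap-++ _ u v)) (mu-++ x n (psi (x (suc n)) u) (psi (x (suc n)) v))

psi-self : ∀ {k} (a : Letter k) → psi a [ a ] ≡ [ a ]
psi-self a with a ≟ a
... | yes _ = refl
... | no a≢a = ⊥-elim (a≢a refl)

psi-other : ∀ {k} {a b : Letter k} → a ≢ b → psi a [ b ] ≡ a ∷ [ b ]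
psi-other {a = a} {b} a≢b with b ≟ a
... | yes b≡a = ⊥-elim (a≢b (sym b≡a))
... | no _ = refl

mu-suc-self : ∀ {k} (x : ℕ → Letter k) j → mu x (suc j) [ x (suc j) ] ≡ h x j
mu-suc-self x j = cong (mu x j) (psi-self (x (suc j)))

mu-suc-other : ∀ {k} (x : ℕ → Letter k) j {a} → x (suc j) ≢ a → mu x (suc j) [ a ] ≡ h x j ++ mu x j [ a ]
mu-suc-other x j {a} ne = trans (cong (mu x j) (psi-other ne)) (mu-++ x j [ x (suc j) ] [ a ])

mu-from-last-occurrence : ∀ {k} (x : ℕ → Letter k) p c →
  (∀ i → suc p < i → i ≤ suc p + c → x i ≢ x (suc p)) →
  mu x (suc p + c) [ x (suc p) ] ≡ hprod x (p + c) (suc c)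
mu-from-last-occurrence x p zero _ rewrite +-identityʳ p =
  trans (mu-suc-self x p) (sym (++-identityʳ (h x p)))
mu-from-last-occurrence x p (suc c) avoids rewrite +-suc p c =
  trans (mu-suc-other x (suc (p + c)) (avoids (suc (suc (p + c))) (s≤s (s≤s (m≤m+n p c))) ≤-refl))
        (cong (h x (suc (p + c)) ++_)
              (mu-from-last-occurrence x p c (λ i p<i i≤ → avoids i p<i (≤-trans i≤ (n≤1+n _)))))

suc-+∸ : ∀ p c → suc (p + c) ∸ p ≡ suc c
suc-+∸ p c = trans (cong (_∸ p) (sym (+-suc p c))) (m+n∸m≡n p (suc c))

lemma1 : ∀ {k} (s : InfWord k) (x : ℕ → Letter k) → StandardEpisturmian s → IsDirectiveWord s x →
    ∀ (n : ℕ) → 2 ≤ n → (P : ℕ) → 1 ≤ P → P < n → x P ≡ x n →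
    (∀ i → P < i → i < n → x i ≢ x n) →
    h x (n ∸ 1) ≡ hprod x (n ∸ 2) (n ∸ P)
lemma1 _ x _ _ n _ (suc p) _ P<n xP≡xn last with m≤n⇒∃[o]m+o≡n P<n
... | c , refl = begin
  mu x (suc p + c) [ x n ]              ≡⟨ cong (λ a → mu x (suc p + c) [ a ]) (sym xP≡xn) ⟩
  mu x (suc p + c) [ x (suc p) ]        ≡⟨ mu-from-last-occurrence x p c avoids ⟩
  hprod x (p + c) (suc c)               ≡⟨ cong (hprod x (p + c)) (sym (suc-+∸ p c)) ⟩
  hprod x (p + c) (suc (p + c) ∸ p)     ∎
  where
  open ≡-Reasoning
  avoids : ∀ i → suc p < i → i ≤ suc p + c → x i ≢ x (suc p)
  avoids i p<i i≤ xi≡xP = last i p<i (s≤s i≤) (trans xi≡xP xP≡xn)
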